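{- Let $n \geq 1$ and $1 \leq r \leq s$ be integers. Let $\mathcal{A}$ be a non-empty family of subsets of $[n]=\{1,\dots,n\}$, each of size at most $r$, and let $\mathcal{B}$ be a non-empty family of subsets of $[n]$, each of size at most $s$, such that $A \cap B \neq \emptyset$ for every $A \in \mathcal{A}$ and every $B \in \mathcal{B}$. Then \[|\mathcal{A}| + |\mathcal{B}| \leq 1 + \sum_{i=1}^s \left({n \choose i} - {n-r \choose i} \right),\] and equality holds if $\mathcal{A} = \{[r]\}$ and $\mathcal{B} = \{B \subseteq [n] \colon |B| \leq s,\ B \cap [r] \neq \emptyset\}$.
   Context: For integers $m\ge 0$, $[m]=\{1,\dots,m\}$ (with $[0]=\emptyset$). Binomial coefficients ${a \choose i}$ with $a<i$ (in particular when $a \le 0 < i$) are $0$. -}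

module Defs where

open import Data.Nat using (ℕ; zero; suc; _+_; _∸_; _<ᵇ_)
open import Data.Nat.Combinatorics using (_C_)
open import Data.Fin using (Fin; toℕ)
open import Data.Fin.Subset using (Subset; inside; outside)
open import Data.Vec using (tabulate)
open import Data.Bool using (if_then_else_)

-- [n] = {1,…,n} is modelled by Fin n (element i ↔ toℕ i + 1).
-- A subset of [n] is a 'Subset n' (characteristic vector).

initSeg : (n r : ℕ) → Subset n
initSeg n r = tabulate (λ (i : Fin n) → if toℕ i <ᵇ r then inside else outside)

-- Here n ∸ r is truncated
-- subtraction; when r > n it is 0 and (0 choose i) = 0 for i ≥ 1, matching
-- the convention that binomials with negative top and i > 0 vanish.
-- Each summand is non-negative, so truncated subtraction is exact.
boundSum : (n r s : ℕ) → ℕ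
boundSum n r zero    = 0
boundSum n r (suc i) = boundSum n r i + ((n C suc i) ∸ ((n ∸ r) C suc i))

-- Split each family by the first point of [n]: 𝒜₀ and 𝒜₁ are the members avoiding
-- and containing it (with the point removed), likewise ℬ₀ and ℬ₁.  When all four parts are non-empty,
-- (𝒜₀ ∪ 𝒜₁, ℬ₀) and (𝒜₀ ∩ 𝒜₁, ℬ₁) are cross-intersecting pairs on n − 1 points with size bounds
-- (r, s) and (r − 1, s − 1) whose sizes add up to |𝒜| + |ℬ|; when a part is empty, the missing
-- estimate comes from counting all sets of bounded size that meet one fixed member of the other
-- family.  The bound f(n, r, s) counts the sets of size 1, …, s meeting [r], so it satisfies
-- f(n + 1, r + 1, s) = f(n, r, s) + Σ_{i<s} C(n, i), and each case reduces to an inequality between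
-- such binomial sums.

module Submission where

open import Defs
open import Data.Bool using (true; false)
import Data.Bool.Properties as Bool
open import Data.Empty using (⊥-elim)
open import Data.Fin using (Fin)
open import Data.Fin.Subset using (Subset; inside; outside; Nonempty; ∣_∣; _∩_)
open import Data.Fin.Subset.Properties using (∩-comm; p∩q≢∅⇒∣p─q∣<∣p∣)
open import Data.List using (List; []; _∷_; [_]; length; filter; _++_)
open import Data.List.Properties using (length-++)
import Data.List.Membership.DecPropositional as DecMembership
open import Data.List.Membership.Propositional using (_∈_)
open import Data.List.Membership.Propositional.Properties using (∈-filter⁻; ∈-++⁻; ∈-++⁺ˡ)
open import Data.List.Relation.Unary.All as All using (All)
open import Data.List.Relation.Unary.Any using (here; there)
open import Data.List.Relation.Unary.Unique.Propositional using (Unique; []; _∷_)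
import Data.List.Relation.Unary.Unique.Propositional.Properties as Unique
open import Data.Nat using (ℕ; zero; suc; _+_; _∸_; _≤_; _<_; _≥_; _≤′_; ≤′-refl; ≤′-step; z≤n; s≤s)
open import Data.Nat.Combinatorics using (_C_; nCk+nC[k+1]≡[n+1]C[k+1])
open import Data.Nat.Properties
open import Algebra.Properties.CommutativeSemigroup +-commutativeSemigroup using (interchange; xy∙z≈xz∙y)
open import Data.Product using (∃; _×_; _,_; proj₁; proj₂)
open import Data.Sum using (_⊎_; inj₁; inj₂; [_,_]′)
open import Data.Vec using ([]; _∷_; here; there)
open import Data.Vec.Properties using (≡-dec)
open import Function using (_∘_)
open import Function.Bundles using (_⇔_; Equivalence)
open import Relation.Binary.Definitions using (DecidableEquality)
open import Relation.Binary.PropositionalEquality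
  using (_≡_; refl; sym; trans; cong; cong₂; subst; module ≡-Reasoning)
open import Relation.Nullary using (does)
open import Relation.Unary using (Decidable)
open import Relation.Unary.Properties using (∁?)

-- Binomial sums

-- binomSum m k counts the subsets of [m] of size < k; meetCount n r i the i-subsets of [n] meeting [r].
binomSum : ℕ → ℕ → ℕ
binomSum m zero    = 0
binomSum m (suc k) = binomSum m k + m C k

meetCount : ℕ → ℕ → ℕ → ℕ
meetCount n r i = (n C i) ∸ ((n ∸ r) C i)

C-pascal : ∀ m k → suc m C suc k ≡ m C k + m C suc k
C-pascal m k = sym (nCk+nC[k+1]≡[n+1]C[k+1] m k)

C-monoˡ-≤ : ∀ k {a b} → a ≤ b → a C k ≤ b C k
C-monoˡ-≤ zero    _ = ≤-refl
C-monoˡ-≤ (suc k) {zero} _ = z≤n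
C-monoˡ-≤ (suc k) {suc a} {suc b} (s≤s a≤b) = begin
  suc a C suc k          ≡⟨ C-pascal a k ⟩
  a C k + a C suc k      ≤⟨ +-mono-≤ (C-monoˡ-≤ k a≤b) (C-monoˡ-≤ (suc k) a≤b) ⟩
  b C k + b C suc k      ≡⟨ C-pascal b k ⟨
  suc b C suc k          ∎
  where open ≤-Reasoning

binomSum-pascal : ∀ m k → binomSum (suc m) (suc k) ≡ binomSum m (suc k) + binomSum m k
binomSum-pascal m zero    = refl
binomSum-pascal m (suc k) = begin
  binomSum (suc m) (suc k) + suc m C suc k
    ≡⟨ cong₂ _+_ (binomSum-pascal m k) (trans (C-pascal m k) (+-comm (m C k) _)) ⟩
  (binomSum m (suc k) + binomSum m k) + (m C suc k + m C k)
    ≡⟨ interchange (binomSum m (suc k)) _ _ _ ⟩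
  binomSum m (suc (suc k)) + binomSum m (suc k)
    ∎
  where open ≡-Reasoning

binomSum-mono-≤ : ∀ m {k l} → k ≤ l → binomSum m k ≤ binomSum m l
binomSum-mono-≤ m k≤l = go (≤⇒≤′ k≤l)
  where
  go : ∀ {k l} → k ≤′ l → binomSum m k ≤ binomSum m l
  go ≤′-refl       = ≤-refl
  go (≤′-step k≤l) = ≤-trans (go k≤l) (m≤m+n _ _)

binomSum-zeroˡ : ∀ k → binomSum 0 (suc k) ≡ 1
binomSum-zeroˡ zero    = refl
binomSum-zeroˡ (suc k) = trans (+-identityʳ _) (binomSum-zeroˡ k)

meetCount-suc : ∀ m r i → meetCount (suc m) (suc r) (suc i) ≡ meetCount m r (suc i) + m C i
meetCount-suc m r i = begin
  suc m C suc i ∸ (m ∸ r) C suc i        ≡⟨ cong (_∸ (m ∸ r) C suc i) (C-pascal m i) ⟩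
  (m C i + m C suc i) ∸ (m ∸ r) C suc i  ≡⟨ +-∸-assoc (m C i) (C-monoˡ-≤ (suc i) (m∸n≤m m r)) ⟩
  m C i + meetCount m r (suc i)          ≡⟨ +-comm (m C i) _ ⟩
  meetCount m r (suc i) + m C i          ∎
  where open ≡-Reasoning

boundSum-suc : ∀ m r k → boundSum (suc m) (suc r) k ≡ boundSum m r k + binomSum m k
boundSum-suc m r zero    = refl
boundSum-suc m r (suc k) = begin
  boundSum (suc m) (suc r) k + meetCount (suc m) (suc r) (suc k)
    ≡⟨ cong₂ _+_ (boundSum-suc m r k) (meetCount-suc m r k) ⟩
  (boundSum m r k + binomSum m k) + (meetCount m r (suc k) + m C k)
    ≡⟨ interchange (boundSum m r k) _ _ _ ⟩
  boundSum m r (suc k) + binomSum m (suc k)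
    ∎
  where open ≡-Reasoning

boundSum-zeroˡ : ∀ r k → boundSum 0 r k ≡ 0
boundSum-zeroˡ r zero    = refl
boundSum-zeroˡ r (suc k) = cong₂ _+_ (boundSum-zeroˡ r k) (0∸n≡0 ((0 ∸ r) C suc k))

boundSum-zeroᵐ : ∀ m k → boundSum m 0 k ≡ 0
boundSum-zeroᵐ m zero    = refl
boundSum-zeroᵐ m (suc k) = cong₂ _+_ (boundSum-zeroᵐ m k) (n∸n≡0 (m C suc k))

boundSum-one : ∀ m k → boundSum (suc m) 1 k ≡ binomSum m k
boundSum-one m k = trans (boundSum-suc m 0 k) (cong (_+ binomSum m k) (boundSum-zeroᵐ m k))

boundSum-pascal-≤ : ∀ m a k → boundSum m a k + boundSum m a (k ∸ 1) ≤ boundSum (suc m) a k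
boundSum-pascal-≤ m zero k rewrite boundSum-zeroᵐ m k | boundSum-zeroᵐ m (k ∸ 1) = z≤n
boundSum-pascal-≤ zero (suc a) k rewrite boundSum-zeroˡ (suc a) k | boundSum-zeroˡ (suc a) (k ∸ 1) = z≤n
boundSum-pascal-≤ (suc m) (suc a) k = begin
  boundSum (suc m) (suc a) k + boundSum (suc m) (suc a) (k ∸ 1)
    ≡⟨ cong₂ _+_ (boundSum-suc m a k) (boundSum-suc m a (k ∸ 1)) ⟩
  (boundSum m a k + binomSum m k) + (boundSum m a (k ∸ 1) + binomSum m (k ∸ 1))
    ≡⟨ interchange (boundSum m a k) _ _ _ ⟩
  (boundSum m a k + boundSum m a (k ∸ 1)) + (binomSum m k + binomSum m (k ∸ 1))
    ≤⟨ +-mono-≤ (boundSum-pascal-≤ m a k) (binomSum-pascal-≤ k) ⟩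
  boundSum (suc m) a k + binomSum (suc m) k
    ≡⟨ boundSum-suc (suc m) a k ⟨
  boundSum (suc (suc m)) (suc a) k ∎
  where
  open ≤-Reasoning
  binomSum-pascal-≤ : ∀ k → binomSum m k + binomSum m (k ∸ 1) ≤ binomSum (suc m) k
  binomSum-pascal-≤ zero    = z≤n
  binomSum-pascal-≤ (suc k) = ≤-reflexive (sym (binomSum-pascal m k))

boundSum-pascal-< : ∀ m r {s} → 1 ≤ s →
  boundSum m (suc r) (suc s) + boundSum m r s < boundSum (suc m) (suc r) (suc s)
boundSum-pascal-< zero r {suc s} _
  rewrite boundSum-zeroˡ (suc r) (suc (suc s)) | boundSum-zeroˡ r (suc s)
        | boundSum-suc zero r (suc (suc s)) | boundSum-zeroˡ r (suc (suc s)) | binomSum-zeroˡ (suc s)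
  = ≤-refl
boundSum-pascal-< (suc m) zero {suc s} _ = begin-strict
  boundSum (suc m) 1 (suc (suc s)) + boundSum (suc m) 0 (suc s)
    ≡⟨ cong₂ _+_ (boundSum-one m (suc (suc s))) (boundSum-zeroᵐ (suc m) (suc s)) ⟩
  binomSum m (suc (suc s)) + 0
    <⟨ +-monoʳ-< (binomSum m (suc (suc s))) (binomSum-mono-≤ m {1} {suc s} (s≤s z≤n)) ⟩
  binomSum m (suc (suc s)) + binomSum m (suc s)
    ≡⟨ binomSum-pascal m (suc s) ⟨
  binomSum (suc m) (suc (suc s))
    ≡⟨ boundSum-one (suc m) (suc (suc s)) ⟨
  boundSum (suc (suc m)) 1 (suc (suc s)) ∎
  where open ≤-Reasoning
boundSum-pascal-< (suc m) (suc r) {suc s} 1≤s = begin-strict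
  boundSum (suc m) (suc (suc r)) (suc (suc s)) + boundSum (suc m) (suc r) (suc s)
    ≡⟨ cong₂ _+_ (boundSum-suc m (suc r) (suc (suc s))) (boundSum-suc m r (suc s)) ⟩
  (boundSum m (suc r) (suc (suc s)) + binomSum m (suc (suc s))) + (boundSum m r (suc s) + binomSum m (suc s))
    ≡⟨ interchange (boundSum m (suc r) (suc (suc s))) _ _ _ ⟩
  (boundSum m (suc r) (suc (suc s)) + boundSum m r (suc s)) + (binomSum m (suc (suc s)) + binomSum m (suc s))
    <⟨ +-monoˡ-< _ (boundSum-pascal-< m r 1≤s) ⟩
  boundSum (suc m) (suc r) (suc (suc s)) + (binomSum m (suc (suc s)) + binomSum m (suc s))
    ≡⟨ cong (boundSum (suc m) (suc r) (suc (suc s)) +_) (binomSum-pascal m (suc s)) ⟨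
  boundSum (suc m) (suc r) (suc (suc s)) + binomSum (suc m) (suc (suc s))
    ≡⟨ boundSum-suc (suc m) (suc r) (suc (suc s)) ⟨
  boundSum (suc (suc m)) (suc (suc r)) (suc (suc s)) ∎
  where open ≤-Reasoning

binomSum≤suc-boundSum : ∀ m k s → k < s → binomSum m (suc k) ≤ suc (boundSum m k s)
binomSum≤suc-boundSum zero k s k<s = begin
  binomSum 0 (suc k)      ≡⟨ binomSum-zeroˡ k ⟩
  1                       ≤⟨ s≤s z≤n ⟩
  suc (boundSum 0 k s)    ∎
  where open ≤-Reasoning
binomSum≤suc-boundSum (suc m) zero s k<s = s≤s z≤n
binomSum≤suc-boundSum (suc m) (suc k) s k<s = begin
  binomSum (suc m) (suc (suc k))
    ≡⟨ binomSum-pascal m (suc k) ⟩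
  binomSum m (suc (suc k)) + binomSum m (suc k)
    ≤⟨ +-mono-≤ (binomSum-mono-≤ m k<s) (binomSum≤suc-boundSum m k s (<-trans (n<1+n k) k<s)) ⟩
  binomSum m s + suc (boundSum m k s)
    ≡⟨ +-suc (binomSum m s) (boundSum m k s) ⟩
  suc (binomSum m s + boundSum m k s)
    ≡⟨ cong suc (trans (+-comm (binomSum m s) _) (sym (boundSum-suc m k s))) ⟩
  suc (boundSum (suc m) (suc k) s) ∎
  where open ≤-Reasoning

boundSum-swap-≤ : ∀ m {a b} → a ≤ b → boundSum m b a ≤ boundSum m a b
boundSum-swap-≤ m {zero} _ = z≤n
boundSum-swap-≤ zero {suc a} {b} _ rewrite boundSum-zeroˡ b (suc a) = z≤n
boundSum-swap-≤ (suc m) {suc a} {suc b} (s≤s a≤b) with m≤n⇒m<n∨m≡n a≤b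
... | inj₂ refl = ≤-refl
... | inj₁ a<b  = begin
  boundSum (suc m) (suc b) (suc a)
    ≡⟨ boundSum-suc m b (suc a) ⟩
  (boundSum m b a + meetCount m b (suc a)) + binomSum m (suc a)
    ≡⟨ +-assoc (boundSum m b a) _ _ ⟩
  boundSum m b a + (meetCount m b (suc a) + binomSum m (suc a))
    ≤⟨ +-mono-≤ (boundSum-swap-≤ m a≤b) (+-monoˡ-≤ (binomSum m (suc a)) (m∸n≤m (m C suc a) ((m ∸ b) C suc a))) ⟩
  boundSum m a b + (m C suc a + binomSum m (suc a))
    ≡⟨ cong (boundSum m a b +_) (+-comm (m C suc a) _) ⟩
  boundSum m a b + binomSum m (suc (suc a))
    ≤⟨ +-monoʳ-≤ (boundSum m a b) (binomSum-mono-≤ m (s≤s a<b)) ⟩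
  boundSum m a b + binomSum m (suc b)
    ≤⟨ +-monoˡ-≤ (binomSum m (suc b)) (m≤m+n (boundSum m a b) _) ⟩
  boundSum m a (suc b) + binomSum m (suc b)
    ≡⟨ boundSum-suc m a (suc b) ⟨
  boundSum (suc m) (suc a) (suc b) ∎
  where open ≤-Reasoning

boundSum-swap-pred-≤ : ∀ m {r s} → r ≤ s → boundSum m s (r ∸ 1) ≤ boundSum m r (s ∸ 1)
boundSum-swap-pred-≤ m {zero} _ = z≤n
boundSum-swap-pred-≤ m {suc zero} _ = z≤n
boundSum-swap-pred-≤ zero {suc (suc r)} {s} _ rewrite boundSum-zeroˡ s (suc r) = z≤n
boundSum-swap-pred-≤ (suc m) {suc (suc r)} {suc (suc s)} (s≤s r+1≤s+1) = begin
  boundSum (suc m) (suc (suc s)) (suc r)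
    ≡⟨ boundSum-suc m (suc s) (suc r) ⟩
  boundSum m (suc s) (suc r) + binomSum m (suc r)
    ≤⟨ +-mono-≤ (boundSum-swap-≤ m r+1≤s+1) (binomSum-mono-≤ m r+1≤s+1) ⟩
  boundSum m (suc r) (suc s) + binomSum m (suc s)
    ≡⟨ boundSum-suc m (suc r) (suc s) ⟨
  boundSum (suc m) (suc (suc r)) (suc s) ∎
  where open ≤-Reasoning

boundSum-pred-+-binomSum-≤ : ∀ m {r s} → r < s → boundSum m r (s ∸ 1) + binomSum m r ≤ boundSum (suc m) r s
boundSum-pred-+-binomSum-≤ m {zero} {s} _ rewrite boundSum-zeroᵐ m (s ∸ 1) = z≤n
boundSum-pred-+-binomSum-≤ m {suc r} {suc (suc s)} (s≤s r<s+1) = begin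
  boundSum m (suc r) (suc s) + binomSum m (suc r)
    ≤⟨ +-monoʳ-≤ (boundSum m (suc r) (suc s)) (binomSum≤suc-boundSum m r (suc (suc s)) (m≤n⇒m≤1+n r<s+1)) ⟩
  boundSum m (suc r) (suc s) + suc (boundSum m r (suc s) + meetCount m r (suc (suc s)))
    ≤⟨ +-monoʳ-≤ (boundSum m (suc r) (suc s)) (s≤s (+-monoʳ-≤ (boundSum m r (suc s)) meetCount-monoᵐ-≤)) ⟩
  boundSum m (suc r) (suc s) + suc (boundSum m r (suc s) + meetCount m (suc r) (suc (suc s)))
    ≡⟨ cong (boundSum m (suc r) (suc s) +_) (cong suc (+-comm (boundSum m r (suc s)) _)) ⟩
  boundSum m (suc r) (suc s) + suc (meetCount m (suc r) (suc (suc s)) + boundSum m r (suc s))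
    ≡⟨ +-suc (boundSum m (suc r) (suc s)) _ ⟩
  suc (boundSum m (suc r) (suc s) + (meetCount m (suc r) (suc (suc s)) + boundSum m r (suc s)))
    ≡⟨ cong suc (+-assoc (boundSum m (suc r) (suc s)) _ _) ⟨
  suc (boundSum m (suc r) (suc (suc s)) + boundSum m r (suc s))
    ≤⟨ boundSum-pascal-< m r (s≤s z≤n) ⟩
  boundSum (suc m) (suc r) (suc (suc s)) ∎
  where
  open ≤-Reasoning
  meetCount-monoᵐ-≤ : meetCount m r (suc (suc s)) ≤ meetCount m (suc r) (suc (suc s))
  meetCount-monoᵐ-≤ = ∸-monoʳ-≤ (m C suc (suc s)) (C-monoˡ-≤ (suc (suc s)) (∸-monoʳ-≤ m (n≤1+n r)))

-- Families of sets

length-filter-∁ : ∀ {a p} {A : Set a} {P : A → Set p} (P? : Decidable P) xs →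
  length (filter P? xs) + length (filter (∁? P?) xs) ≡ length xs
length-filter-∁ P? [] = refl
length-filter-∁ P? (x ∷ xs) with does (P? x)
... | true  = cong suc (length-filter-∁ P? xs)
... | false = trans (+-suc _ _) (cong suc (length-filter-∁ P? xs))

module FamilyUnion {a} {A : Set a} (_≟_ : DecidableEquality A) where

  open DecMembership _≟_ using (_∈?_; _∉?_)

  union : List A → List A → List A
  union 𝒳 𝒴 = 𝒳 ++ filter (_∉? 𝒳) 𝒴

  common : List A → List A → List A
  common 𝒳 𝒴 = filter (_∈? 𝒳) 𝒴

  length-union+common : ∀ 𝒳 𝒴 → length (union 𝒳 𝒴) + length (common 𝒳 𝒴) ≡ length 𝒳 + length 𝒴
  length-union+common 𝒳 𝒴 = begin
    length (𝒳 ++ filter (_∉? 𝒳) 𝒴) + length (common 𝒳 𝒴)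
      ≡⟨ cong (_+ length (common 𝒳 𝒴)) (length-++ 𝒳) ⟩
    (length 𝒳 + length (filter (_∉? 𝒳) 𝒴)) + length (common 𝒳 𝒴)
      ≡⟨ +-assoc (length 𝒳) _ _ ⟩
    length 𝒳 + (length (filter (_∉? 𝒳) 𝒴) + length (common 𝒳 𝒴))
      ≡⟨ cong (length 𝒳 +_) (trans (+-comm _ (length (common 𝒳 𝒴))) (length-filter-∁ (_∈? 𝒳) 𝒴)) ⟩
    length 𝒳 + length 𝒴 ∎
    where open ≡-Reasoning

  union-unique : ∀ {𝒳 𝒴} → Unique 𝒳 → Unique 𝒴 → Unique (union 𝒳 𝒴)
  union-unique {𝒳} {𝒴} u v = Unique.++⁺ u (Unique.filter⁺ (_∉? 𝒳) v)
    (λ (x∈𝒳 , x∈rest) → proj₂ (∈-filter⁻ (_∉? 𝒳) {xs = 𝒴} x∈rest) x∈𝒳)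

  common-unique : ∀ {𝒳 𝒴} → Unique 𝒴 → Unique (common 𝒳 𝒴)
  common-unique {𝒳} = Unique.filter⁺ (_∈? 𝒳)

  ∈-union⁻ : ∀ {x} 𝒳 𝒴 → x ∈ union 𝒳 𝒴 → x ∈ 𝒳 ⊎ x ∈ 𝒴
  ∈-union⁻ 𝒳 𝒴 x∈ with ∈-++⁻ 𝒳 x∈
  ... | inj₁ x∈𝒳    = inj₁ x∈𝒳
  ... | inj₂ x∈rest = inj₂ (proj₁ (∈-filter⁻ (_∉? 𝒳) x∈rest))

  ∈-union⁺ˡ : ∀ {x 𝒳} 𝒴 → x ∈ 𝒳 → x ∈ union 𝒳 𝒴
  ∈-union⁺ˡ _ = ∈-++⁺ˡ

  ∈-common⁻ : ∀ {x} 𝒳 𝒴 → x ∈ common 𝒳 𝒴 → x ∈ 𝒳 × x ∈ 𝒴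
  ∈-common⁻ 𝒳 𝒴 x∈ = let (x∈𝒴 , x∈𝒳) = ∈-filter⁻ (_∈? 𝒳) x∈ in x∈𝒳 , x∈𝒴

drop-∷-Nonempty : ∀ {m} {p : Subset m} → Nonempty (outside ∷ p) → Nonempty p
drop-∷-Nonempty (Fin.suc x , there x∈p) = x , x∈p

∣initSeg∣≤r : ∀ n r → ∣ initSeg n r ∣ ≤ r
∣initSeg∣≤r zero    r       = z≤n
∣initSeg∣≤r (suc n) zero    = ∣initSeg∣≤r n zero
∣initSeg∣≤r (suc n) (suc r) = s≤s (∣initSeg∣≤r n r)

module _ {m : ℕ} where

  avoiding₀ : List (Subset (suc m)) → List (Subset m)
  avoiding₀ []                  = []
  avoiding₀ ((outside ∷ A) ∷ ℒ) = A ∷ avoiding₀ ℒ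
  avoiding₀ ((inside  ∷ A) ∷ ℒ) = avoiding₀ ℒ

  containing₀ : List (Subset (suc m)) → List (Subset m)
  containing₀ []                  = []
  containing₀ ((outside ∷ A) ∷ ℒ) = containing₀ ℒ
  containing₀ ((inside  ∷ A) ∷ ℒ) = A ∷ containing₀ ℒ

  length-split₀ : ∀ ℒ → length ℒ ≡ length (avoiding₀ ℒ) + length (containing₀ ℒ)
  length-split₀ []                  = refl
  length-split₀ ((outside ∷ A) ∷ ℒ) = cong suc (length-split₀ ℒ)
  length-split₀ ((inside  ∷ A) ∷ ℒ) = trans (cong suc (length-split₀ ℒ)) (sym (+-suc _ _))

  ∈-avoiding₀⁺ : ∀ {A} ℒ → (outside ∷ A) ∈ ℒ → A ∈ avoiding₀ ℒ
  ∈-avoiding₀⁺ ((outside ∷ B) ∷ ℒ) (here refl) = here refl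
  ∈-avoiding₀⁺ ((outside ∷ B) ∷ ℒ) (there A∈)  = there (∈-avoiding₀⁺ ℒ A∈)
  ∈-avoiding₀⁺ ((inside  ∷ B) ∷ ℒ) (there A∈)  = ∈-avoiding₀⁺ ℒ A∈

  ∈-avoiding₀⁻ : ∀ {A} ℒ → A ∈ avoiding₀ ℒ → (outside ∷ A) ∈ ℒ
  ∈-avoiding₀⁻ ((outside ∷ B) ∷ ℒ) (here refl) = here refl
  ∈-avoiding₀⁻ ((outside ∷ B) ∷ ℒ) (there A∈)  = there (∈-avoiding₀⁻ ℒ A∈)
  ∈-avoiding₀⁻ ((inside  ∷ B) ∷ ℒ) A∈          = there (∈-avoiding₀⁻ ℒ A∈)

  ∈-containing₀⁺ : ∀ {A} ℒ → (inside ∷ A) ∈ ℒ → A ∈ containing₀ ℒ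
  ∈-containing₀⁺ ((inside  ∷ B) ∷ ℒ) (here refl) = here refl
  ∈-containing₀⁺ ((inside  ∷ B) ∷ ℒ) (there A∈)  = there (∈-containing₀⁺ ℒ A∈)
  ∈-containing₀⁺ ((outside ∷ B) ∷ ℒ) (there A∈)  = ∈-containing₀⁺ ℒ A∈

  ∈-containing₀⁻ : ∀ {A} ℒ → A ∈ containing₀ ℒ → (inside ∷ A) ∈ ℒ
  ∈-containing₀⁻ ((inside  ∷ B) ∷ ℒ) (here refl) = here refl
  ∈-containing₀⁻ ((inside  ∷ B) ∷ ℒ) (there A∈)  = there (∈-containing₀⁻ ℒ A∈)
  ∈-containing₀⁻ ((outside ∷ B) ∷ ℒ) A∈          = there (∈-containing₀⁻ ℒ A∈)

  avoiding₀-unique : ∀ {ℒ} → Unique ℒ → Unique (avoiding₀ ℒ)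
  avoiding₀-unique {[]} [] = []
  avoiding₀-unique {(outside ∷ A) ∷ ℒ} (A∉ℒ ∷ u) =
    All.tabulate (λ B∈ A≡B → All.lookup A∉ℒ (∈-avoiding₀⁻ ℒ B∈) (cong (outside ∷_) A≡B))
    ∷ avoiding₀-unique u
  avoiding₀-unique {(inside ∷ A) ∷ ℒ} (_ ∷ u) = avoiding₀-unique u

  containing₀-unique : ∀ {ℒ} → Unique ℒ → Unique (containing₀ ℒ)
  containing₀-unique {[]} [] = []
  containing₀-unique {(inside ∷ A) ∷ ℒ} (A∉ℒ ∷ u) =
    All.tabulate (λ B∈ A≡B → All.lookup A∉ℒ (∈-containing₀⁻ ℒ B∈) (cong (inside ∷_) A≡B))
    ∷ containing₀-unique u
  containing₀-unique {(outside ∷ A) ∷ ℒ} (_ ∷ u) = containing₀-unique u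

  avoiding₀-view : ∀ ℒ → ∃ (_∈ ℒ) → ∃ (_∈ avoiding₀ ℒ) ⊎ (avoiding₀ ℒ ≡ [] × ∃ (_∈ containing₀ ℒ))
  avoiding₀-view ℒ _ with avoiding₀ ℒ in eq
  avoiding₀-view ℒ _                  | A ∷ _ = inj₁ (A , here refl)
  avoiding₀-view ℒ (inside  ∷ A , A∈) | []    = inj₂ (refl , A , ∈-containing₀⁺ ℒ A∈)
  avoiding₀-view ℒ (outside ∷ A , A∈) | []
    with () ← subst (A ∈_) eq (∈-avoiding₀⁺ ℒ A∈)

-- Counting families of bounded sets

length≤binomSum : ∀ m k (ℒ : List (Subset m)) → Unique ℒ → (∀ {B} → B ∈ ℒ → ∣ B ∣ < k) →
  length ℒ ≤ binomSum m k
length≤binomSum m       zero    []      _ _ = z≤n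
length≤binomSum m       zero    (B ∷ ℒ) _ small with () ← small (here refl)
length≤binomSum zero    (suc k) []      _ _ = z≤n
length≤binomSum zero    (suc k) ([] ∷ []) _ _ = ≤-reflexive (sym (binomSum-zeroˡ k))
length≤binomSum zero    (suc k) ([] ∷ [] ∷ ℒ) (≢ℒ ∷ _) _ = ⊥-elim (All.head ≢ℒ refl)
length≤binomSum (suc m) (suc k) ℒ u small = begin
  length ℒ
    ≡⟨ length-split₀ ℒ ⟩
  length (avoiding₀ ℒ) + length (containing₀ ℒ)
    ≤⟨ +-mono-≤ (length≤binomSum m (suc k) (avoiding₀ ℒ) (avoiding₀-unique u) (small ∘ ∈-avoiding₀⁻ ℒ))
                (length≤binomSum m k (containing₀ ℒ) (containing₀-unique u) (≤-pred ∘ small ∘ ∈-containing₀⁻ ℒ)) ⟩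
  binomSum m (suc k) + binomSum m k
    ≡⟨ binomSum-pascal m k ⟨
  binomSum (suc m) (suc k) ∎
  where open ≤-Reasoning

length≤boundSum : ∀ m a k (A : Subset m) → ∣ A ∣ ≤ a → (ℒ : List (Subset m)) → Unique ℒ →
  (∀ {B} → B ∈ ℒ → ∣ B ∣ ≤ k × Nonempty (B ∩ A)) → length ℒ ≤ boundSum m a k
length≤boundSum zero a k [] _ [] _ _ = z≤n
length≤boundSum zero a k [] _ (B ∷ ℒ) _ meets with () ← proj₂ (meets (here refl))
length≤boundSum (suc m) (suc a) k (inside ∷ A) (s≤s ∣A∣≤a) ℒ u meets = begin
  length ℒ
    ≡⟨ length-split₀ ℒ ⟩
  length (avoiding₀ ℒ) + length (containing₀ ℒ)
    ≤⟨ +-mono-≤ (length≤boundSum m a k A ∣A∣≤a (avoiding₀ ℒ) (avoiding₀-unique u) avoiding-meets)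
                (length≤binomSum m k (containing₀ ℒ) (containing₀-unique u) (proj₁ ∘ meets ∘ ∈-containing₀⁻ ℒ)) ⟩
  boundSum m a k + binomSum m k
    ≡⟨ boundSum-suc m a k ⟨
  boundSum (suc m) (suc a) k ∎
  where
  open ≤-Reasoning
  avoiding-meets : ∀ {B} → B ∈ avoiding₀ ℒ → ∣ B ∣ ≤ k × Nonempty (B ∩ A)
  avoiding-meets B∈ = let (∣B∣≤k , meet) = meets (∈-avoiding₀⁻ ℒ B∈) in ∣B∣≤k , drop-∷-Nonempty meet
length≤boundSum (suc m) a k (outside ∷ A) ∣A∣≤a ℒ u meets = begin
  length ℒ
    ≡⟨ length-split₀ ℒ ⟩
  length (avoiding₀ ℒ) + length (containing₀ ℒ)
    ≤⟨ +-mono-≤ (length≤boundSum m a k A ∣A∣≤a (avoiding₀ ℒ) (avoiding₀-unique u) avoiding-meets)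
                (length≤boundSum m a (k ∸ 1) A ∣A∣≤a (containing₀ ℒ) (containing₀-unique u) containing-meets) ⟩
  boundSum m a k + boundSum m a (k ∸ 1)
    ≤⟨ boundSum-pascal-≤ m a k ⟩
  boundSum (suc m) a k ∎
  where
  open ≤-Reasoning
  avoiding-meets : ∀ {B} → B ∈ avoiding₀ ℒ → ∣ B ∣ ≤ k × Nonempty (B ∩ A)
  avoiding-meets B∈ = let (∣B∣≤k , meet) = meets (∈-avoiding₀⁻ ℒ B∈) in ∣B∣≤k , drop-∷-Nonempty meet
  containing-meets : ∀ {B} → B ∈ containing₀ ℒ → ∣ B ∣ ≤ k ∸ 1 × Nonempty (B ∩ A)
  containing-meets B∈ with meets (∈-containing₀⁻ ℒ B∈)
  ... | s≤s ∣B∣≤k-1 , meet = ∣B∣≤k-1 , drop-∷-Nonempty meet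

binomSum≤length : ∀ m k (ℒ : List (Subset m)) → (∀ B → ∣ B ∣ < k → B ∈ ℒ) → binomSum m k ≤ length ℒ
binomSum≤length m       zero    ℒ _ = z≤n
binomSum≤length zero    (suc k) ℒ complete with complete [] (s≤s z≤n)
... | []∈ℒ = begin
  binomSum 0 (suc k) ≡⟨ binomSum-zeroˡ k ⟩
  1                  ≤⟨ nonempty-length []∈ℒ ⟩
  length ℒ           ∎
  where
  open ≤-Reasoning
  nonempty-length : ∀ {ℳ : List (Subset 0)} → [] ∈ ℳ → 1 ≤ length ℳ
  nonempty-length {_ ∷ _} _ = s≤s z≤n
binomSum≤length (suc m) (suc k) ℒ complete = begin
  binomSum (suc m) (suc k)
    ≡⟨ binomSum-pascal m k ⟩
  binomSum m (suc k) + binomSum m k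
    ≤⟨ +-mono-≤ (binomSum≤length m (suc k) (avoiding₀ ℒ) (λ B ∣B∣<k+1 → ∈-avoiding₀⁺ ℒ (complete (outside ∷ B) ∣B∣<k+1)))
                (binomSum≤length m k (containing₀ ℒ) (λ B ∣B∣<k → ∈-containing₀⁺ ℒ (complete (inside ∷ B) (s≤s ∣B∣<k)))) ⟩
  length (avoiding₀ ℒ) + length (containing₀ ℒ)
    ≡⟨ length-split₀ ℒ ⟨
  length ℒ ∎
  where open ≤-Reasoning

boundSum≤length : ∀ n r s (ℒ : List (Subset n)) →
  (∀ B → ∣ B ∣ ≤ s → Nonempty (B ∩ initSeg n r) → B ∈ ℒ) → boundSum n r s ≤ length ℒ
boundSum≤length zero    r       s ℒ _ = ≤-trans (≤-reflexive (boundSum-zeroˡ r s)) z≤n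
boundSum≤length (suc n) zero    s ℒ _ = ≤-trans (≤-reflexive (boundSum-zeroᵐ (suc n) s)) z≤n
boundSum≤length (suc n) (suc r) s ℒ complete = begin
  boundSum (suc n) (suc r) s
    ≡⟨ boundSum-suc n r s ⟩
  boundSum n r s + binomSum n s
    ≤⟨ +-mono-≤ (boundSum≤length n r s (avoiding₀ ℒ)
                   (λ B ∣B∣≤s (x , x∈) → ∈-avoiding₀⁺ ℒ (complete (outside ∷ B) ∣B∣≤s (Fin.suc x , there x∈))))
                (binomSum≤length n s (containing₀ ℒ)
                   (λ B ∣B∣<s → ∈-containing₀⁺ ℒ (complete (inside ∷ B) ∣B∣<s (Fin.zero , here)))) ⟩
  length (avoiding₀ ℒ) + length (containing₀ ℒ)
    ≡⟨ length-split₀ ℒ ⟨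
  length ℒ ∎
  where open ≤-Reasoning

-- Cross-intersecting families

record SmallFamily {n} (r : ℕ) (𝒜 : List (Subset n)) : Set where
  field
    unique : Unique 𝒜
    small  : ∀ {A} → A ∈ 𝒜 → ∣ A ∣ ≤ r

open SmallFamily

Cross : ∀ {n} → List (Subset n) → List (Subset n) → Set
Cross 𝒜 ℬ = ∀ {A B} → A ∈ 𝒜 → B ∈ ℬ → Nonempty (A ∩ B)

Nonempty-∩⇒1≤∣p∣ : ∀ {n} (p q : Subset n) → Nonempty (p ∩ q) → 1 ≤ ∣ p ∣
Nonempty-∩⇒1≤∣p∣ p q p∩q≢∅ = ≤-trans (s≤s z≤n) (p∩q≢∅⇒∣p─q∣<∣p∣ p q p∩q≢∅)

[]-or-member : ∀ {a} {A : Set a} (xs : List A) → xs ≡ [] ⊎ ∃ (_∈ xs)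
[]-or-member []      = inj₁ refl
[]-or-member (x ∷ _) = inj₂ (x , here refl)

cross-sym : ∀ {n} {𝒜 ℬ : List (Subset n)} → Cross 𝒜 ℬ → Cross ℬ 𝒜
cross-sym cross {A} {B} A∈ B∈ = subst Nonempty (∩-comm B A) (cross B∈ A∈)

module _ {m : ℕ} where

  open FamilyUnion {A = Subset m} (≡-dec Bool._≟_)

  small-weaken : ∀ {r r′} {𝒜 : List (Subset m)} → r ≤ r′ → SmallFamily r 𝒜 → SmallFamily r′ 𝒜
  small-weaken r≤r′ 𝔄 = record { unique = unique 𝔄 ; small = λ A∈ → ≤-trans (small 𝔄 A∈) r≤r′ }

  union-small : ∀ {r} {𝒳 𝒴 : List (Subset m)} → SmallFamily r 𝒳 → SmallFamily r 𝒴 → SmallFamily r (union 𝒳 𝒴)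
  union-small {𝒳 = 𝒳} {𝒴} 𝔛 𝔜 = record
    { unique = union-unique (unique 𝔛) (unique 𝔜)
    ; small  = λ A∈ → [ small 𝔛 , small 𝔜 ]′ (∈-union⁻ 𝒳 𝒴 A∈)
    }

  common-small : ∀ {r} {𝒳 𝒴 : List (Subset m)} → SmallFamily r 𝒴 → SmallFamily r (common 𝒳 𝒴)
  common-small {𝒳 = 𝒳} {𝒴} 𝔜 = record
    { unique = common-unique (unique 𝔜)
    ; small  = small 𝔜 ∘ proj₂ ∘ ∈-common⁻ 𝒳 𝒴
    }

  cross-unionˡ : ∀ {𝒳 𝒴 𝒵 : List (Subset m)} → Cross 𝒳 𝒵 → Cross 𝒴 𝒵 → Cross (union 𝒳 𝒴) 𝒵
  cross-unionˡ {𝒳} {𝒴} cross𝒳 cross𝒴 A∈ C∈ = [ (λ A∈𝒳 → cross𝒳 A∈𝒳 C∈) , (λ A∈𝒴 → cross𝒴 A∈𝒴 C∈) ]′ (∈-union⁻ 𝒳 𝒴 A∈)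

module _ {m : ℕ} {𝒜 : List (Subset (suc m))} where

  avoiding₀-small : ∀ {r} → SmallFamily r 𝒜 → SmallFamily r (avoiding₀ 𝒜)
  avoiding₀-small 𝔄 = record
    { unique = avoiding₀-unique (unique 𝔄)
    ; small  = small 𝔄 ∘ ∈-avoiding₀⁻ 𝒜
    }

  containing₀-small : ∀ {r} → SmallFamily r 𝒜 → SmallFamily (r ∸ 1) (containing₀ 𝒜)
  containing₀-small 𝔄 = record
    { unique = containing₀-unique (unique 𝔄)
    ; small  = ∸-monoˡ-≤ 1 ∘ small 𝔄 ∘ ∈-containing₀⁻ 𝒜
    }

  module _ {ℬ : List (Subset (suc m))} (cross : Cross 𝒜 ℬ) where

    cross-avoiding₀ : Cross (avoiding₀ 𝒜) (avoiding₀ ℬ)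
    cross-avoiding₀ A∈ B∈ = drop-∷-Nonempty (cross (∈-avoiding₀⁻ 𝒜 A∈) (∈-avoiding₀⁻ ℬ B∈))

    cross-avoiding₀-containing₀ : Cross (avoiding₀ 𝒜) (containing₀ ℬ)
    cross-avoiding₀-containing₀ A∈ B∈ = drop-∷-Nonempty (cross (∈-avoiding₀⁻ 𝒜 A∈) (∈-containing₀⁻ ℬ B∈))

    cross-containing₀-avoiding₀ : Cross (containing₀ 𝒜) (avoiding₀ ℬ)
    cross-containing₀-avoiding₀ A∈ B∈ = drop-∷-Nonempty (cross (∈-containing₀⁻ 𝒜 A∈) (∈-avoiding₀⁻ ℬ B∈))

CrossBound : ℕ → Set
CrossBound n = ∀ {r s} {𝒜 ℬ : List (Subset n)} → r ≤ s → SmallFamily r 𝒜 → SmallFamily s ℬ →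
  ∃ (_∈ 𝒜) → ∃ (_∈ ℬ) → Cross 𝒜 ℬ → length 𝒜 + length ℬ ≤ suc (boundSum n r s)

-- 𝒞 or 𝒟 may be empty; the other one is then bounded by counting the sets that meet A or B.
crossBound-anchored : ∀ {m} → CrossBound m → ∀ {r s} {𝒞 𝒟 : List (Subset m)} → r ≤ s →
  SmallFamily r 𝒞 → SmallFamily s 𝒟 → Cross 𝒞 𝒟 → (A B : Subset m) → ∣ A ∣ ≤ suc r → ∣ B ∣ ≤ suc s →
  (∀ {Y} → Y ∈ 𝒟 → Nonempty (Y ∩ A)) → (∀ {X} → X ∈ 𝒞 → Nonempty (X ∩ B)) →
  boundSum m (suc r) (suc s) + (length 𝒞 + length 𝒟) ≤ boundSum (suc m) (suc r) (suc s)
crossBound-anchored {m} ih {r} {s} {𝒞} {𝒟} r≤s ℭ 𝔇 cross A B ∣A∣≤r+1 ∣B∣≤s+1 𝒟-meets-A 𝒞-meets-B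
  with []-or-member 𝒞 | []-or-member 𝒟
... | inj₁ refl | _ = begin
  boundSum m (suc r) (suc s) + length 𝒟
    ≤⟨ +-monoʳ-≤ _ (length≤boundSum m (suc r) s A ∣A∣≤r+1 𝒟 (unique 𝔇) (λ D∈ → small 𝔇 D∈ , 𝒟-meets-A D∈)) ⟩
  boundSum m (suc r) (suc s) + boundSum m (suc r) s
    ≤⟨ boundSum-pascal-≤ m (suc r) (suc s) ⟩
  boundSum (suc m) (suc r) (suc s) ∎
  where open ≤-Reasoning
... | inj₂ _ | inj₁ refl = begin
  boundSum m (suc r) (suc s) + (length 𝒞 + 0)
    ≡⟨ cong (boundSum m (suc r) (suc s) +_) (+-identityʳ (length 𝒞)) ⟩
  boundSum m (suc r) (suc s) + length 𝒞
    ≤⟨ +-monoʳ-≤ _ (length≤boundSum m (suc s) r B ∣B∣≤s+1 𝒞 (unique ℭ) (λ X∈ → small ℭ X∈ , 𝒞-meets-B X∈)) ⟩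
  boundSum m (suc r) (suc s) + boundSum m (suc s) r
    ≤⟨ +-monoʳ-≤ _ (boundSum-swap-pred-≤ m (s≤s r≤s)) ⟩
  boundSum m (suc r) (suc s) + boundSum m (suc r) s
    ≤⟨ boundSum-pascal-≤ m (suc r) (suc s) ⟩
  boundSum (suc m) (suc r) (suc s) ∎
  where open ≤-Reasoning
... | inj₂ (X , X∈) | inj₂ (Y , Y∈) = begin
  boundSum m (suc r) (suc s) + (length 𝒞 + length 𝒟)
    ≤⟨ +-monoʳ-≤ _ (ih r≤s ℭ 𝔇 (X , X∈) (Y , Y∈) cross) ⟩
  boundSum m (suc r) (suc s) + suc (boundSum m r s)
    ≡⟨ +-suc _ _ ⟩
  suc (boundSum m (suc r) (suc s) + boundSum m r s)
    ≤⟨ boundSum-pascal-< m r 1≤s ⟩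
  boundSum (suc m) (suc r) (suc s) ∎
  where
  open ≤-Reasoning
  1≤s : 1 ≤ s
  1≤s = ≤-trans (Nonempty-∩⇒1≤∣p∣ X Y (cross X∈ Y∈)) (≤-trans (small ℭ X∈) r≤s)

module Step {m : ℕ} (ih : CrossBound m) {r s : ℕ} {𝒜 ℬ : List (Subset (suc m))}
  (r≤s : r ≤ s) (𝔄 : SmallFamily (suc r) 𝒜) (𝔅 : SmallFamily (suc s) ℬ) (cross : Cross 𝒜 ℬ) where

  open FamilyUnion {A = Subset m} (≡-dec Bool._≟_)
  open ≤-Reasoning

  𝒜₀ 𝒜₁ ℬ₀ ℬ₁ : List (Subset m)
  𝒜₀ = avoiding₀ 𝒜
  𝒜₁ = containing₀ 𝒜
  ℬ₀ = avoiding₀ ℬ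
  ℬ₁ = containing₀ ℬ

  all𝒜-contain₀-bound : 𝒜₀ ≡ [] → ∃ (_∈ 𝒜₁) → length 𝒜 + length ℬ ≤ suc (boundSum (suc m) (suc r) (suc s))
  all𝒜-contain₀-bound 𝒜₀≡[] ne𝒜₁ = begin
    length 𝒜 + length ℬ
      ≡⟨ cong₂ _+_ (trans (length-split₀ 𝒜) (cong (λ 𝒳 → length 𝒳 + length 𝒜₁) 𝒜₀≡[])) (length-split₀ ℬ) ⟩
    length 𝒜₁ + (length ℬ₀ + length ℬ₁)
      ≡⟨ +-assoc (length 𝒜₁) _ _ ⟨
    (length 𝒜₁ + length ℬ₀) + length ℬ₁
      ≤⟨ +-mono-≤ 𝒜₁ℬ₀-bound (length≤binomSum m (suc s) ℬ₁ (unique 𝔅₁) (s≤s ∘ small 𝔅₁)) ⟩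
    suc (boundSum m r (suc s)) + binomSum m (suc s)
      ≡⟨ cong suc (boundSum-suc m r (suc s)) ⟨
    suc (boundSum (suc m) (suc r) (suc s)) ∎
    where
    𝔄₁ : SmallFamily r 𝒜₁
    𝔄₁ = containing₀-small 𝔄
    𝔅₁ : SmallFamily s ℬ₁
    𝔅₁ = containing₀-small 𝔅
    𝒜₁ℬ₀-bound : length 𝒜₁ + length ℬ₀ ≤ suc (boundSum m r (suc s))
    𝒜₁ℬ₀-bound with []-or-member ℬ₀
    ... | inj₂ neℬ₀  = ih (m≤n⇒m≤1+n r≤s) 𝔄₁ (avoiding₀-small 𝔅) ne𝒜₁ neℬ₀ (cross-containing₀-avoiding₀ cross)
    ... | inj₁ ℬ₀≡[] = begin
      length 𝒜₁ + length ℬ₀    ≡⟨ cong (λ 𝒳 → length 𝒜₁ + length 𝒳) ℬ₀≡[] ⟩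
      length 𝒜₁ + 0            ≡⟨ +-identityʳ (length 𝒜₁) ⟩
      length 𝒜₁                ≤⟨ length≤binomSum m (suc r) 𝒜₁ (unique 𝔄₁) (s≤s ∘ small 𝔄₁) ⟩
      binomSum m (suc r)       ≤⟨ binomSum≤suc-boundSum m r (suc s) (s≤s r≤s) ⟩
      suc (boundSum m r (suc s)) ∎

  allℬ-contain₀-bound : r < s → ∃ (_∈ 𝒜₀) → ℬ₀ ≡ [] → ∃ (_∈ ℬ₁) →
    length 𝒜 + length ℬ ≤ suc (boundSum (suc m) (suc r) (suc s))
  allℬ-contain₀-bound r<s ne𝒜₀ ℬ₀≡[] neℬ₁ = begin
    length 𝒜 + length ℬ
      ≡⟨ cong₂ _+_ (length-split₀ 𝒜) (trans (length-split₀ ℬ) (cong (λ 𝒳 → length 𝒳 + length ℬ₁) ℬ₀≡[])) ⟩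
    (length 𝒜₀ + length 𝒜₁) + length ℬ₁
      ≡⟨ xy∙z≈xz∙y (length 𝒜₀) _ _ ⟩
    (length 𝒜₀ + length ℬ₁) + length 𝒜₁
      ≤⟨ +-mono-≤ (ih r<s (avoiding₀-small 𝔄) (containing₀-small 𝔅) ne𝒜₀ neℬ₁ (cross-avoiding₀-containing₀ cross))
                  (length≤binomSum m (suc r) 𝒜₁ (unique 𝔄₁) (s≤s ∘ small 𝔄₁)) ⟩
    suc (boundSum m (suc r) s + binomSum m (suc r))
      ≤⟨ s≤s (boundSum-pred-+-binomSum-≤ m (s≤s r<s)) ⟩
    suc (boundSum (suc m) (suc r) (suc s)) ∎
    where
    𝔄₁ : SmallFamily r 𝒜₁
    𝔄₁ = containing₀-small 𝔄

  both-avoid₀-bound : ∃ (_∈ 𝒜₀) → ∃ (_∈ ℬ₀) → length 𝒜 + length ℬ ≤ suc (boundSum (suc m) (suc r) (suc s))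
  both-avoid₀-bound (A , A∈) (B , B∈) = begin
    length 𝒜 + length ℬ
      ≡⟨ cong₂ _+_ (trans (length-split₀ 𝒜) (sym (length-union+common 𝒜₀ 𝒜₁))) (length-split₀ ℬ) ⟩
    (length (union 𝒜₀ 𝒜₁) + length (common 𝒜₀ 𝒜₁)) + (length ℬ₀ + length ℬ₁)
      ≡⟨ interchange (length (union 𝒜₀ 𝒜₁)) _ _ _ ⟩
    (length (union 𝒜₀ 𝒜₁) + length ℬ₀) + (length (common 𝒜₀ 𝒜₁) + length ℬ₁)
      ≤⟨ +-monoˡ-≤ _ (ih (s≤s r≤s) (union-small 𝔄₀ (small-weaken (n≤1+n r) 𝔄₁)) 𝔅₀
                        (A , ∈-union⁺ˡ 𝒜₁ A∈) (B , B∈) (cross-unionˡ cross₀₀ cross₁₀)) ⟩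
    suc (boundSum m (suc r) (suc s) + (length (common 𝒜₀ 𝒜₁) + length ℬ₁))
      ≤⟨ s≤s (crossBound-anchored ih r≤s (common-small 𝔄₁) 𝔅₁ (cross₀₁ ∘ proj₁ ∘ ∈-common⁻ 𝒜₀ 𝒜₁)
                A B (small 𝔄₀ A∈) (small 𝔅₀ B∈) (λ D∈ → cross-sym cross₀₁ D∈ A∈)
                (λ C∈ → cross₀₀ (proj₁ (∈-common⁻ 𝒜₀ 𝒜₁ C∈)) B∈)) ⟩
    suc (boundSum (suc m) (suc r) (suc s)) ∎
    where
    𝔄₀ : SmallFamily (suc r) 𝒜₀
    𝔄₀ = avoiding₀-small 𝔄
    𝔄₁ : SmallFamily r 𝒜₁
    𝔄₁ = containing₀-small 𝔄
    𝔅₀ : SmallFamily (suc s) ℬ₀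
    𝔅₀ = avoiding₀-small 𝔅
    𝔅₁ : SmallFamily s ℬ₁
    𝔅₁ = containing₀-small 𝔅
    cross₀₀ : Cross 𝒜₀ ℬ₀
    cross₀₀ = cross-avoiding₀ cross
    cross₀₁ : Cross 𝒜₀ ℬ₁
    cross₀₁ = cross-avoiding₀-containing₀ cross
    cross₁₀ : Cross 𝒜₁ ℬ₀
    cross₁₀ = cross-containing₀-avoiding₀ cross

crossBound : ∀ n → CrossBound n
crossBound n {zero} _ 𝔄 _ (A , A∈) (B , B∈) cross
  with () ← ≤-trans (Nonempty-∩⇒1≤∣p∣ A B (cross A∈ B∈)) (small 𝔄 A∈)
crossBound zero _ _ _ ([] , A∈) (B , B∈) cross
  with () ← Nonempty-∩⇒1≤∣p∣ [] B (cross A∈ B∈)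
crossBound (suc m) {suc r} {suc s} {𝒜} {ℬ} (s≤s r≤s) 𝔄 𝔅 ne𝒜 neℬ cross
  with avoiding₀-view 𝒜 ne𝒜 | avoiding₀-view ℬ neℬ | m≤n⇒m<n∨m≡n r≤s
... | inj₂ (𝒜₀≡[] , ne𝒜₁) | _ | _ =
  Step.all𝒜-contain₀-bound (crossBound m) r≤s 𝔄 𝔅 cross 𝒜₀≡[] ne𝒜₁
... | inj₁ ne𝒜₀ | inj₁ neℬ₀ | _ =
  Step.both-avoid₀-bound (crossBound m) r≤s 𝔄 𝔅 cross ne𝒜₀ neℬ₀
... | inj₁ ne𝒜₀ | inj₂ (ℬ₀≡[] , neℬ₁) | inj₁ r<s =
  Step.allℬ-contain₀-bound (crossBound m) r≤s 𝔄 𝔅 cross r<s ne𝒜₀ ℬ₀≡[] neℬ₁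
... | inj₁ _ | inj₂ (ℬ₀≡[] , neℬ₁) | inj₂ refl =
  subst (_≤ suc (boundSum (suc m) (suc r) (suc r))) (+-comm (length ℬ) (length 𝒜))
    (Step.all𝒜-contain₀-bound (crossBound m) ≤-refl 𝔅 𝔄 (cross-sym cross) ℬ₀≡[] neℬ₁)

length≥1⇒member : ∀ {a} {A : Set a} {xs : List A} → length xs ≥ 1 → ∃ (_∈ xs)
length≥1⇒member {xs = x ∷ _} _ = x , here refl

theorem1 : (n r s : ℕ) → n ≥ 1 → 1 ≤ r → r ≤ s →
    ((𝒜 ℬ : List (Subset n)) → Unique 𝒜 → Unique ℬ →
      length 𝒜 ≥ 1 → length ℬ ≥ 1 →
      All (λ A → ∣ A ∣ ≤ r) 𝒜 → All (λ B → ∣ B ∣ ≤ s) ℬ →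
      (∀ A B → A ∈ 𝒜 → B ∈ ℬ → Nonempty (A ∩ B)) →
      length 𝒜 + length ℬ ≤ 1 + boundSum n r s)
    ×
    (r ≤ n → (ℬ : List (Subset n)) → Unique ℬ →
      (∀ B → (B ∈ ℬ) ⇔ ((∣ B ∣ ≤ s) × Nonempty (B ∩ initSeg n r))) →
      length [ initSeg n r ] + length ℬ ≡ 1 + boundSum n r s)
theorem1 n r s _ _ r≤s =
  (λ 𝒜 ℬ u𝒜 uℬ 𝒜≢[] ℬ≢[] small𝒜 smallℬ cross →
    crossBound n r≤s
      (record { unique = u𝒜 ; small = All.lookup small𝒜 })
      (record { unique = uℬ ; small = All.lookup smallℬ })
      (length≥1⇒member 𝒜≢[]) (length≥1⇒member ℬ≢[]) (cross _ _)) ,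
  (λ _ ℬ uℬ ∈ℬ⇔ → cong suc (≤-antisym
    (length≤boundSum n r s (initSeg n r) (∣initSeg∣≤r n r) ℬ uℬ (Equivalence.to (∈ℬ⇔ _)))
    (boundSum≤length n r s ℬ (λ B ∣B∣≤s meets → Equivalence.from (∈ℬ⇔ B) (∣B∣≤s , meets)))))
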